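{- Let $n\geq 7$, let $\mathcal{F}$ be an inclusion-maximal independent set of $\Gamma(n,1,n-3)$ and let $A\subseteq[n]$ with $|A|=1$. Then the $\mathcal{F}$-weight of $A$ equals $\binom{n-1}{3}$ if and only if $A\subseteq B'$ for every flag $(A',B')\in\mathcal{F}$. Moreover, if the $\mathcal{F}$-weight of $A$ is less than $\binom{n-1}{3}$, then it is at most $\binom{n-1}{3}-\binom{n-4}{2}$.
   Context: $[n]=\{1,\dots,n\}$. The graph $\Gamma(n,1,n-3)$ has as vertices the pairs (flags) $(A,B)$ with $A\subseteq B\subseteq[n]$, $|A|=1$, $|B|=n-3$; two vertices $(A_1,B_1),(A_2,B_2)$ are adjacent (opposite) iff $B_1\cup B_2=[n]$, $A_1\cap B_2=\emptyset$ and $A_2\cap B_1=\emptyset$. An independent set is a set of pairwise non-adjacent vertices. For an independent set $\mathcal{F}$ and a $1$-subset $A\subseteq[n]$, the $\mathcal{F}$-weight of $A$ is the number of flags in $\mathcal{F}$ whose first component is $A$. -}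

module Defs where

open import Data.Nat using (ℕ; zero; suc; _∸_)
open import Data.Bool using (Bool; true; false; if_then_else_)
open import Data.Fin using (Fin)
open import Data.Fin.Subset using (Subset; _∈_; _∉_; _∪_; ⊤; ∣_∣; inside; outside)
open import Data.List using (List; []; _∷_; _++_; map)
open import Data.Nat.ListAction using (sum)
open import Data.Vec using (_∷_; [])
open import Data.Product using (_×_; Σ)
open import Relation.Nullary using (¬_)
open import Relation.Binary.PropositionalEquality using (_≡_)

allSubsets : (n : ℕ) → List (Subset n)
allSubsets zero = [] ∷ []
allSubsets (suc n) = map (outside ∷_) (allSubsets n) ++ map (inside ∷_) (allSubsets n)

-- A flag (A,B) of Γ(n,1,n-3): A = {a} is a 1-subset, encoded by its element a,
-- and B is an (n-3)-subset containing a.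
IsFlag : (n : ℕ) → Fin n → Subset n → Set
IsFlag n a B = (a ∈ B) × (∣ B ∣ ≡ n ∸ 3)

Opposite : {n : ℕ} → Fin n → Subset n → Fin n → Subset n → Set
Opposite a₁ B₁ a₂ B₂ = (B₁ ∪ B₂ ≡ ⊤) × (a₁ ∉ B₂) × (a₂ ∉ B₁)

Family : ℕ → Set
Family n = Fin n → Subset n → Bool

IsIndependentSet : (n : ℕ) → Family n → Set
IsIndependentSet n F =
  ((a : Fin n) (B : Subset n) → F a B ≡ true → IsFlag n a B) ×
  ((a₁ : Fin n) (B₁ : Subset n) (a₂ : Fin n) (B₂ : Subset n) →
     F a₁ B₁ ≡ true → F a₂ B₂ ≡ true → ¬ Opposite a₁ B₁ a₂ B₂)

_⊆F_ : {n : ℕ} → Family n → Family n → Set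
_⊆F_ {n} F G = (a : Fin n) (B : Subset n) → F a B ≡ true → G a B ≡ true

IsMaximalIndependentSet : (n : ℕ) → Family n → Set
IsMaximalIndependentSet n F =
  IsIndependentSet n F ×
  ((G : Family n) → IsIndependentSet n G → F ⊆F G → G ⊆F F)

weight : {n : ℕ} → Family n → Fin n → ℕ
weight {n} F a = sum (map (λ B → if F a B then 1 else 0) (allSubsets n))

-- The flags with first component {a} are the (n − 3)-sets containing a, so the weight of {a} is
-- at most (n − 1) C 3. If a lies in the second component of every member of F, then no flag at a
-- is opposite to a member of F or to another flag at a, so by maximality F contains all of them.
-- If instead some (a′, B′) ∈ F has a ∉ B′, then each (n − 3)-set B containing the 3-set ∁ B′ (which
-- contains a) and avoiding a′ gives a flag ({a}, B) opposite to (a′, B′), hence missing from F;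
-- there are (n − 4) C 2 of them. Both counts are instances of counting the sets of a given size
-- that contain some prescribed elements and avoid others.
module Submission where

open import Defs
open import Data.Bool using (Bool; true; false; not; _∧_; _∨_; T; if_then_else_)
open import Data.Bool.Properties using (T-∧; T-∨; T-≡; ∧-zeroʳ; not-involutive)
open import Data.Empty using (⊥; ⊥-elim)
open import Data.Fin using (Fin; zero; suc; _≟_)
open import Data.Fin.Subset using (Subset; _∈_; _∉_; _⊆_; _∪_; ∁; ⊤; ⁅_⁆; ∣_∣; inside; outside)
open import Data.Fin.Subset.Properties
  using (_∈?_; drop-∷-⊆; ⊆⊤; ⊆-antisym; p⊆p∪q; q⊆p∪q; x∉p⇒x∈∁p; x∈p⇒x∉∁p; x∈⁅x⁆; x∈⁅y⁆⇒x≡y;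
         ∣⁅x⁆∣≡1; ∣∁p∣≡n∸∣p∣)
open import Data.List using (List; []; _∷_; _++_; map)
open import Data.List.Properties using (map-++; map-∘)
open import Data.Nat using (ℕ; zero; suc; _+_; _∸_; _≤_; _<_; _≡ᵇ_; z≤n; s≤s; _≤?_)
open import Data.Nat.Combinatorics using (_C_; nCk≡nC[n∸k]; nCk+nC[k+1]≡[n+1]C[k+1])
open import Data.Nat.ListAction using (sum)
open import Data.Nat.ListAction.Properties using (sum-++)
open import Data.Nat.Properties
  using (+-mono-≤; ≤-refl; +-identityʳ; +-suc; +-comm; <-trans; n<1+n; suc-injective; ≡⇒≡ᵇ; ≡ᵇ⇒≡;
         ≤-antisym; <-≤-trans; m≤m+n; m≤n+m; m+n∸n≡m; +-cancelˡ-≤; <⇒≱; <⇒≢; m+n≤o⇒m≤o∸n;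
         +-commutativeSemigroup; module ≤-Reasoning)
open import Algebra.Properties.CommutativeSemigroup +-commutativeSemigroup using (interchange)
open import Data.Product using (_×_; _,_; proj₁; proj₂)
open import Data.Sum using (_⊎_; inj₁; inj₂)
open import Data.Vec using (Vec; []; _∷_; _[_]≔_; _[_]=_; here; there)
open import Function using (_∘_; Equivalence)
open import Relation.Nullary using (¬_; yes; no; contradiction)
open import Relation.Nullary.Decidable using (⌊_⌋; toWitness; fromWitness)
open import Relation.Binary.PropositionalEquality
  using (_≡_; refl; sym; trans; cong; cong₂; subst; subst₂; module ≡-Reasoning)

private
  variable
    A : Set
    m n : ℕ

-- Shaped so that weight F a is definitionally #subsets (F a).
countWhere : (A → Bool) → List A → ℕ
countWhere P xs = sum (map (λ x → if P x then 1 else 0) xs)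

countWhere-++ : (P : A → Bool) (xs ys : List A) →
  countWhere P (xs ++ ys) ≡ countWhere P xs + countWhere P ys
countWhere-++ P xs ys = trans (cong sum (map-++ _ xs ys)) (sum-++ (map _ xs) _)

countWhere-map : {B : Set} (P : A → Bool) (f : B → A) (xs : List B) →
  countWhere P (map f xs) ≡ countWhere (P ∘ f) xs
countWhere-map P f xs = cong sum (sym (map-∘ xs))

countWhere-none : {P : A → Bool} (xs : List A) → (∀ x → P x ≡ false) → countWhere P xs ≡ 0
countWhere-none []       _ = refl
countWhere-none (x ∷ xs) h rewrite h x = countWhere-none xs h

if-mono : {p q : Bool} → (T p → T q) → (if p then 1 else 0) ≤ (if q then 1 else 0)
if-mono {false}         _ = z≤n
if-mono {true} {true}   _ = ≤-refl
if-mono {true} {false} pq = ⊥-elim (pq _)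

if-disjoint : {p q r : Bool} → (T p → T r) → (T q → T r) → (T p → T q → ⊥) →
  (if p then 1 else 0) + (if q then 1 else 0) ≤ (if r then 1 else 0)
if-disjoint {false} {false}          _  _  _    = z≤n
if-disjoint {true}  {true}           _  _  disj = ⊥-elim (disj _ _)
if-disjoint {true}  {false} {true}   _  _  _    = ≤-refl
if-disjoint {false} {true}  {true}   _  _  _    = ≤-refl
if-disjoint {true}  {false} {false}  pr _  _    = ⊥-elim (pr _)
if-disjoint {false} {true}  {false}  _  qr _    = ⊥-elim (qr _)

countWhere-mono : {P Q : A → Bool} (xs : List A) → (∀ x → T (P x) → T (Q x)) →
  countWhere P xs ≤ countWhere Q xs
countWhere-mono []       _ = z≤n
countWhere-mono (x ∷ xs) h = +-mono-≤ (if-mono (h x)) (countWhere-mono xs h)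

countWhere-disjoint : {P Q R : A → Bool} (xs : List A) →
  (∀ x → T (P x) → T (R x)) → (∀ x → T (Q x) → T (R x)) → (∀ x → T (P x) → T (Q x) → ⊥) →
  countWhere P xs + countWhere Q xs ≤ countWhere R xs
countWhere-disjoint []       _  _  _    = z≤n
countWhere-disjoint {P = P} {Q} (x ∷ xs) pr qr disj = begin
  (p + countWhere P xs) + (q + countWhere Q xs) ≡⟨ interchange p _ q _ ⟩
  (p + q) + (countWhere P xs + countWhere Q xs) ≤⟨ +-mono-≤ (if-disjoint (pr x) (qr x) (disj x))
                                                             (countWhere-disjoint xs pr qr disj) ⟩
  _                                            ∎
  where
  open ≤-Reasoning
  p q : ℕ
  p = if P x then 1 else 0
  q = if Q x then 1 else 0

#subsets : (Subset n → Bool) → ℕ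
#subsets {n} P = countWhere P (allSubsets n)

#subsets-suc : (P : Subset (suc n) → Bool) →
  #subsets P ≡ #subsets (P ∘ (outside ∷_)) + #subsets (P ∘ (inside ∷_))
#subsets-suc {n} P = trans (countWhere-++ P (map (outside ∷_) (allSubsets n)) _)
  (cong₂ _+_ (countWhere-map P _ (allSubsets n)) (countWhere-map P _ (allSubsets n)))

data Constraint : Set where
  required forbidden free : Constraint

Pattern : ℕ → Set
Pattern = Vec Constraint

satisfies : Constraint → Bool → Bool
satisfies required  b = b
satisfies forbidden b = not b
satisfies free      _ = true

matches : Pattern n → Subset n → Bool
matches []      []      = true
matches (c ∷ p) (b ∷ B) = satisfies c b ∧ matches p B

matchesOfSize : Pattern n → ℕ → Subset n → Bool
matchesOfSize p k B = matches p B ∧ (∣ B ∣ ≡ᵇ k)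

#required #free : Pattern n → ℕ
#required []              = 0
#required (required  ∷ p) = suc (#required p)
#required (forbidden ∷ p) = #required p
#required (free      ∷ p) = #required p
#free []              = 0
#free (required  ∷ p) = #free p
#free (forbidden ∷ p) = #free p
#free (free      ∷ p) = suc (#free p)

#matching : Pattern n → ℕ → ℕ
#matching p k = #subsets (matchesOfSize p k)

module _ (p : Pattern n) where

  #matching-required-zero : #matching (required ∷ p) 0 ≡ 0
  #matching-required-zero = trans (#subsets-suc (matchesOfSize (required ∷ p) 0))
    (cong₂ _+_ (countWhere-none (allSubsets n) (λ _ → refl))
               (countWhere-none (allSubsets n) (λ B → ∧-zeroʳ (matches p B))))

  #matching-required-suc : ∀ k → #matching (required ∷ p) (suc k) ≡ #matching p k
  #matching-required-suc k = trans (#subsets-suc (matchesOfSize (required ∷ p) (suc k)))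
    (cong (_+ #matching p k) (countWhere-none (allSubsets n) (λ _ → refl)))

  #matching-forbidden : ∀ k → #matching (forbidden ∷ p) k ≡ #matching p k
  #matching-forbidden k = trans (#subsets-suc (matchesOfSize (forbidden ∷ p) k))
    (trans (cong (#matching p k +_) (countWhere-none (allSubsets n) (λ _ → refl))) (+-identityʳ _))

  #matching-free-zero : #matching (free ∷ p) 0 ≡ #matching p 0
  #matching-free-zero = trans (#subsets-suc (matchesOfSize (free ∷ p) 0))
    (trans (cong (#matching p 0 +_) (countWhere-none (allSubsets n) (λ B → ∧-zeroʳ (matches p B))))
      (+-identityʳ _))

  #matching-free-suc : ∀ k → #matching (free ∷ p) (suc k) ≡ #matching p (suc k) + #matching p k
  #matching-free-suc k = #subsets-suc (matchesOfSize (free ∷ p) (suc k))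

#matching-below-required : (p : Pattern n) {k : ℕ} → k < #required p → #matching p k ≡ 0
#matching-below-required []              ()
#matching-below-required (required  ∷ p) {zero}  _         = #matching-required-zero p
#matching-below-required (required  ∷ p) {suc k} (s≤s k<r) =
  trans (#matching-required-suc p k) (#matching-below-required p k<r)
#matching-below-required (forbidden ∷ p) {k}     k<r       =
  trans (#matching-forbidden p k) (#matching-below-required p k<r)
#matching-below-required (free      ∷ p) {zero}  0<r       =
  trans (#matching-free-zero p) (#matching-below-required p 0<r)
#matching-below-required (free      ∷ p) {suc k} k<r       = begin
  #matching (free ∷ p) (suc k)            ≡⟨ #matching-free-suc p k ⟩
  #matching p (suc k) + #matching p k     ≡⟨ cong₂ _+_ (#matching-below-required p k<r)
                                                       (#matching-below-required p (<-trans (n<1+n k) k<r)) ⟩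
  0                                       ∎
  where open ≡-Reasoning

#matching-free-at-required : (p : Pattern n) → #matching (free ∷ p) (#required p) ≡ #matching p (#required p)
#matching-free-at-required p with #required p | #matching-below-required p
... | zero  | _     = #matching-free-zero p
... | suc r | below = trans (#matching-free-suc p r)
  (trans (cong (#matching p (suc r) +_) (below (n<1+n r))) (+-identityʳ _))

-- A set matching p of size #required p + j is determined by which j of the free positions it contains.
#matching-exact : (p : Pattern n) (j : ℕ) → #matching p (#required p + j) ≡ #free p C j
#matching-exact []              zero    = refl
#matching-exact []              (suc j) = refl
#matching-exact (required  ∷ p) j       = trans (#matching-required-suc p _) (#matching-exact p j)
#matching-exact (forbidden ∷ p) j       = trans (#matching-forbidden p _) (#matching-exact p j)
#matching-exact (free      ∷ p) zero    = begin
  #matching (free ∷ p) (#required p + 0) ≡⟨ cong (#matching (free ∷ p)) (+-identityʳ _) ⟩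
  #matching (free ∷ p) (#required p)     ≡⟨ #matching-free-at-required p ⟩
  #matching p (#required p)              ≡⟨ cong (#matching p) (+-identityʳ _) ⟨
  #matching p (#required p + 0)          ≡⟨ #matching-exact p 0 ⟩
  1                                      ∎
  where open ≡-Reasoning
#matching-exact (free      ∷ p) (suc j) = begin
  #matching (free ∷ p) (r + suc j)              ≡⟨ cong (#matching (free ∷ p)) (+-suc r j) ⟩
  #matching (free ∷ p) (suc (r + j))            ≡⟨ #matching-free-suc p (r + j) ⟩
  #matching p (suc (r + j)) + #matching p (r + j) ≡⟨ cong (λ k → #matching p k + #matching p (r + j)) (+-suc r j) ⟨
  #matching p (r + suc j) + #matching p (r + j) ≡⟨ cong₂ _+_ (#matching-exact p (suc j)) (#matching-exact p j) ⟩
  #free p C suc j + #free p C j                 ≡⟨ +-comm (#free p C suc j) _ ⟩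
  #free p C j + #free p C suc j                 ≡⟨ nCk+nC[k+1]≡[n+1]C[k+1] (#free p) j ⟩
  suc (#free p) C suc j                         ∎
  where
  open ≡-Reasoning
  r = #required p

#matching-via : (p : Pattern n) {r f : ℕ} (j : ℕ) → #required p ≡ r → #free p ≡ f →
  #matching p (r + j) ≡ f C j
#matching-via p j refl refl = #matching-exact p j

supersetsOf : Subset n → Pattern n
supersetsOf []            = []
supersetsOf (inside  ∷ X) = required ∷ supersetsOf X
supersetsOf (outside ∷ X) = free ∷ supersetsOf X

matches-supersetsOf⁺ : (X B : Subset n) → X ⊆ B → T (matches (supersetsOf X) B)
matches-supersetsOf⁺ []            []            _   = _
matches-supersetsOf⁺ (inside  ∷ X) (inside  ∷ B) X⊆B = matches-supersetsOf⁺ X B (drop-∷-⊆ X⊆B)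
matches-supersetsOf⁺ (inside  ∷ X) (outside ∷ B) X⊆B with X⊆B here
... | ()
matches-supersetsOf⁺ (outside ∷ X) (_       ∷ B) X⊆B = matches-supersetsOf⁺ X B (drop-∷-⊆ X⊆B)

matches-supersetsOf⁻ : (X B : Subset n) → T (matches (supersetsOf X) B) → X ⊆ B
matches-supersetsOf⁻ (inside  ∷ X) (inside ∷ B) _ here        = here
matches-supersetsOf⁻ (inside  ∷ X) (inside ∷ B) t (there x∈X) = there (matches-supersetsOf⁻ X B t x∈X)
matches-supersetsOf⁻ (outside ∷ X) (_      ∷ B) t (there x∈X) = there (matches-supersetsOf⁻ X B t x∈X)

#required-supersetsOf : (X : Subset n) → #required (supersetsOf X) ≡ ∣ X ∣
#required-supersetsOf []            = refl
#required-supersetsOf (inside  ∷ X) = cong suc (#required-supersetsOf X)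
#required-supersetsOf (outside ∷ X) = #required-supersetsOf X

#free-supersetsOf : (X : Subset n) → #free (supersetsOf X) ≡ ∣ ∁ X ∣
#free-supersetsOf []            = refl
#free-supersetsOf (inside  ∷ X) = #free-supersetsOf X
#free-supersetsOf (outside ∷ X) = cong suc (#free-supersetsOf X)

supersetsOf-free : {X : Subset n} {x : Fin n} → x ∉ X → supersetsOf X [ x ]= free
supersetsOf-free {X = outside ∷ X} {zero}  _   = here
supersetsOf-free {X = inside  ∷ X} {zero}  x∉X = ⊥-elim (x∉X here)
supersetsOf-free {X = inside  ∷ X} {suc x} x∉X = there (supersetsOf-free (x∉X ∘ there))
supersetsOf-free {X = outside ∷ X} {suc x} x∉X = there (supersetsOf-free (x∉X ∘ there))

matches-forbid : {p : Pattern n} {i : Fin n} → p [ i ]= free → (B : Subset n) →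
  T (matches (p [ i ]≔ forbidden) B) → T (matches p B) × i ∉ B
matches-forbid here (outside ∷ B) t = t , λ ()
matches-forbid (there loc) (b ∷ B) t with Equivalence.to T-∧ t
... | sat , rest with matches-forbid loc B rest
...   | m , i∉B = Equivalence.from T-∧ (sat , m) , λ { (there i∈B) → i∉B i∈B }

#required-forbid : {p : Pattern n} {i : Fin n} → p [ i ]= free → #required (p [ i ]≔ forbidden) ≡ #required p
#required-forbid here                        = refl
#required-forbid (there {y = required}  loc) = cong suc (#required-forbid loc)
#required-forbid (there {y = forbidden} loc) = #required-forbid loc
#required-forbid (there {y = free}      loc) = #required-forbid loc

#free-forbid : {p : Pattern n} {i : Fin n} → p [ i ]= free → suc (#free (p [ i ]≔ forbidden)) ≡ #free p
#free-forbid here                        = refl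
#free-forbid (there {y = required}  loc) = #free-forbid loc
#free-forbid (there {y = forbidden} loc) = #free-forbid loc
#free-forbid (there {y = free}      loc) = cong suc (#free-forbid loc)

∁-involutive : (X : Subset n) → ∁ (∁ X) ≡ X
∁-involutive []      = refl
∁-involutive (b ∷ X) = cong₂ _∷_ (not-involutive b) (∁-involutive X)

∁q⊆p⇒p∪q≡⊤ : (p q : Subset n) → ∁ q ⊆ p → p ∪ q ≡ ⊤
∁q⊆p⇒p∪q≡⊤ p q ∁q⊆p = ⊆-antisym ⊆⊤ ⊤⊆p∪q
  where
  ⊤⊆p∪q : ⊤ ⊆ p ∪ q
  ⊤⊆p∪q {x} _ with x ∈? q
  ... | yes x∈q = q⊆p∪q p q x∈q
  ... | no  x∉q = p⊆p∪q q (∁q⊆p (x∉p⇒x∈∁p x∉q))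

x∈p⇒⁅x⁆⊆p : {x : Fin n} {p : Subset n} → x ∈ p → ⁅ x ⁆ ⊆ p
x∈p⇒⁅x⁆⊆p {x = x} {p} x∈p y∈⁅x⁆ = subst (_∈ p) (sym (x∈⁅y⁆⇒x≡y x y∈⁅x⁆)) x∈p

-- The sets B for which ({a}, B) is opposite to (a′, B′), provided a ∉ B′.
opposedBy : Fin n → Subset n → Pattern n
opposedBy a′ B′ = supersetsOf (∁ B′) [ a′ ]≔ forbidden

matches-opposedBy : {a′ : Fin n} {B′ : Subset n} → a′ ∈ B′ → (B : Subset n) →
  T (matches (opposedBy a′ B′) B) → ∁ B′ ⊆ B × a′ ∉ B
matches-opposedBy {B′ = B′} a′∈B′ B t with matches-forbid (supersetsOf-free (x∈p⇒x∉∁p a′∈B′)) B t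
... | m , a′∉B = matches-supersetsOf⁻ (∁ B′) B m , a′∉B

#matching-opposedBy : {a′ : Fin n} {B′ : Subset n} {s : ℕ} → a′ ∈ B′ → ∣ B′ ∣ ≡ suc s → (j : ℕ) →
  #matching (opposedBy a′ B′) (∣ ∁ B′ ∣ + j) ≡ s C j
#matching-opposedBy {a′ = a′} {B′} a′∈B′ size j = #matching-via (opposedBy a′ B′) j
  (trans (#required-forbid a′-free) (#required-supersetsOf (∁ B′)))
  (suc-injective (begin
    suc (#free (opposedBy a′ B′)) ≡⟨ #free-forbid a′-free ⟩
    #free (supersetsOf (∁ B′))    ≡⟨ #free-supersetsOf (∁ B′) ⟩
    ∣ ∁ (∁ B′) ∣                  ≡⟨ cong ∣_∣ (∁-involutive B′) ⟩
    ∣ B′ ∣                        ≡⟨ size ⟩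
    suc _                         ∎))
  where
  open ≡-Reasoning
  a′-free : supersetsOf (∁ B′) [ a′ ]= free
  a′-free = supersetsOf-free (x∈p⇒x∉∁p a′∈B′)

#matching-singleton : (a : Fin (suc m)) (j : ℕ) → #matching (supersetsOf ⁅ a ⁆) (suc j) ≡ m C j
#matching-singleton {m} a j = #matching-via (supersetsOf ⁅ a ⁆) j
  (trans (#required-supersetsOf ⁅ a ⁆) (∣⁅x⁆∣≡1 a))
  (trans (#free-supersetsOf ⁅ a ⁆) (trans (∣∁p∣≡n∸∣p∣ ⁅ a ⁆) (cong (suc m ∸_) (∣⁅x⁆∣≡1 a))))

InAllFlags : Family n → Fin n → Set
InAllFlags {n} F a = (a′ : Fin n) (B′ : Subset n) → F a′ B′ ≡ true → a ∈ B′

isFlagᵇ : Fin n → Subset n → Bool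
isFlagᵇ {n} a = matchesOfSize (supersetsOf ⁅ a ⁆) (n ∸ 3)

#flags : Fin n → ℕ
#flags a = #subsets (isFlagᵇ a)

isFlag⇒isFlagᵇ : {a : Fin n} {B : Subset n} → IsFlag n a B → T (isFlagᵇ a B)
isFlag⇒isFlagᵇ {a = a} {B} (a∈B , size) =
  Equivalence.from T-∧ (matches-supersetsOf⁺ ⁅ a ⁆ B (x∈p⇒⁅x⁆⊆p a∈B) , ≡⇒≡ᵇ _ _ size)

isFlagᵇ⇒isFlag : {a : Fin n} {B : Subset n} → T (isFlagᵇ a B) → IsFlag n a B
isFlagᵇ⇒isFlag {a = a} {B} t with Equivalence.to T-∧ t
... | m , size = matches-supersetsOf⁻ ⁅ a ⁆ B m (x∈⁅x⁆ a) , ≡ᵇ⇒≡ _ _ size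

module _ {F : Family n} (independent : IsIndependentSet n F) (a : Fin n) where

  member⇒isFlagᵇ : (B : Subset n) → T (F a B) → T (isFlagᵇ a B)
  member⇒isFlagᵇ B t = isFlag⇒isFlagᵇ (proj₁ independent a B (Equivalence.to T-≡ t))

  weight≤#flags : weight F a ≤ #flags a
  weight≤#flags = countWhere-mono (allSubsets n) member⇒isFlagᵇ

  weight+#opposed≤#flags : {a′ : Fin n} {B′ : Subset n} → F a′ B′ ≡ true → a ∉ B′ →
    weight F a + #matching (opposedBy a′ B′) (n ∸ 3) ≤ #flags a
  weight+#opposed≤#flags {a′} {B′} inF a∉B′ =
    countWhere-disjoint (allSubsets n) member⇒isFlagᵇ opposedFlag (λ B → notBoth B ∘ Equivalence.to T-≡)
    where
    a′∈B′ : a′ ∈ B′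
    a′∈B′ = proj₁ (proj₁ independent a′ B′ inF)

    opposedFlag : ∀ B → T (matchesOfSize (opposedBy a′ B′) (n ∸ 3) B) → T (isFlagᵇ a B)
    opposedFlag B t with Equivalence.to T-∧ t
    ... | m , size with matches-opposedBy a′∈B′ B m
    ...   | ∁B′⊆B , _ = Equivalence.from T-∧
      (matches-supersetsOf⁺ ⁅ a ⁆ B (x∈p⇒⁅x⁆⊆p (∁B′⊆B (x∉p⇒x∈∁p a∉B′))) , size)

    notBoth : ∀ B → F a B ≡ true → T (matchesOfSize (opposedBy a′ B′) (n ∸ 3) B) → ⊥
    notBoth B inF′ t with matches-opposedBy a′∈B′ B (proj₁ (Equivalence.to T-∧ t))
    ... | ∁B′⊆B , a′∉B = proj₂ independent a B a′ B′ inF′ inF (∁q⊆p⇒p∪q≡⊤ B B′ ∁B′⊆B , a∉B′ , a′∉B)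

module _ {F : Family n} (maximal : IsMaximalIndependentSet n F) (a : Fin n) (inAll : InAllFlags F a) where

  private
    independent : IsIndependentSet n F
    independent = proj₁ maximal

  withFlagsAt : Family n
  withFlagsAt x B = F x B ∨ (⌊ x ≟ a ⌋ ∧ isFlagᵇ a B)

  withFlagsAt-cases : (x : Fin n) (B : Subset n) → withFlagsAt x B ≡ true →
    F x B ≡ true ⊎ (x ≡ a × IsFlag n a B)
  withFlagsAt-cases x B e with Equivalence.to (T-∨ {F x B}) (Equivalence.from T-≡ e)
  ... | inj₁ inF = inj₁ (Equivalence.to T-≡ inF)
  ... | inj₂ t with Equivalence.to (T-∧ {⌊ x ≟ a ⌋}) t
  ...   | x≡a , flag = inj₂ (toWitness {a? = x ≟ a} x≡a , isFlagᵇ⇒isFlag flag)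

  -- Opposition to ({a}, B) needs a ∉ B₂, whereas every flag at a, and by inAll every member of F,
  -- has a in its second component.
  withFlagsAt-independent : IsIndependentSet n withFlagsAt
  withFlagsAt-independent = isFlag , notOpposite
    where
    isFlag : (x : Fin n) (B : Subset n) → withFlagsAt x B ≡ true → IsFlag n x B
    isFlag x B e with withFlagsAt-cases x B e
    ... | inj₁ inF           = proj₁ independent x B inF
    ... | inj₂ (refl , flag) = flag

    notOpposite : (a₁ : Fin n) (B₁ : Subset n) (a₂ : Fin n) (B₂ : Subset n) →
      withFlagsAt a₁ B₁ ≡ true → withFlagsAt a₂ B₂ ≡ true → ¬ Opposite a₁ B₁ a₂ B₂
    notOpposite a₁ B₁ a₂ B₂ e₁ e₂ opposite@(_ , a₁∉B₂ , a₂∉B₁)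
      with withFlagsAt-cases a₁ B₁ e₁ | withFlagsAt-cases a₂ B₂ e₂
    ... | inj₁ inF₁        | inj₁ inF₂            = proj₂ independent a₁ B₁ a₂ B₂ inF₁ inF₂ opposite
    ... | inj₂ (refl , _)  | inj₁ inF₂            = a₁∉B₂ (inAll a₂ B₂ inF₂)
    ... | inj₁ inF₁        | inj₂ (refl , _)      = a₂∉B₁ (inAll a₁ B₁ inF₁)
    ... | inj₂ (refl , _)  | inj₂ (refl , flag₂)  = a₁∉B₂ (proj₁ flag₂)

  F⊆withFlagsAt : F ⊆F withFlagsAt
  F⊆withFlagsAt x B inF rewrite inF = refl

  isFlagᵇ⇒member : (B : Subset n) → T (isFlagᵇ a B) → T (F a B)
  isFlagᵇ⇒member B t = Equivalence.from T-≡
    (proj₂ maximal withFlagsAt withFlagsAt-independent F⊆withFlagsAt a B (Equivalence.to T-≡ inExtension))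
    where
    inExtension : T (withFlagsAt a B)
    inExtension = Equivalence.from (T-∨ {F a B})
      (inj₂ (Equivalence.from T-∧ (fromWitness {a? = a ≟ a} refl , t)))

  weight≡#flags : weight F a ≡ #flags a
  weight≡#flags = ≤-antisym (weight≤#flags independent a) (countWhere-mono (allSubsets n) isFlagᵇ⇒member)

0<nCk : {n k : ℕ} → k ≤ n → 0 < n C k
0<nCk {k = zero}          _         = s≤s z≤n
0<nCk {suc n} {suc k} (s≤s k≤n) =
  subst (0 <_) (nCk+nC[k+1]≡[n+1]C[k+1] n k) (<-≤-trans (0<nCk k≤n) (m≤m+n _ _))

[k+j]Cj≡[k+j]Ck : (k j : ℕ) → (k + j) C j ≡ (k + j) C k
[k+j]Cj≡[k+j]Ck k j = trans (nCk≡nC[n∸k] (m≤n+m j k)) (cong ((k + j) C_) (m+n∸n≡m k j))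

-- With n = 6 + m the paper's binomials are (n − 1) C 3 = (5 + m) C 3 and (n − 4) C 2 = (2 + m) C 2;
-- the argument needs only n ≥ 6.
module _ {m : ℕ} {F : Family (6 + m)} (maximal : IsMaximalIndependentSet (6 + m) F) (a : Fin (6 + m)) where

  private
    independent : IsIndependentSet (6 + m) F
    independent = proj₁ maximal

  #flags≡[5+m]C3 : #flags a ≡ (5 + m) C 3
  #flags≡[5+m]C3 = trans (#matching-singleton a (2 + m)) ([k+j]Cj≡[k+j]Ck 3 (2 + m))

  #opposed≡[2+m]C2 : {a′ : Fin (6 + m)} {B′ : Subset (6 + m)} → F a′ B′ ≡ true →
    #matching (opposedBy a′ B′) (3 + m) ≡ (2 + m) C 2
  #opposed≡[2+m]C2 {a′} {B′} inF with proj₁ independent a′ B′ inF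
  ... | a′∈B′ , size = begin
    #matching (opposedBy a′ B′) (3 + m)          ≡⟨ cong (λ r → #matching (opposedBy a′ B′) (r + m)) ∣∁B′∣≡3 ⟨
    #matching (opposedBy a′ B′) (∣ ∁ B′ ∣ + m)   ≡⟨ #matching-opposedBy a′∈B′ size m ⟩
    (2 + m) C m                                 ≡⟨ [k+j]Cj≡[k+j]Ck 2 m ⟩
    (2 + m) C 2                                 ∎
    where
    open ≡-Reasoning
    ∣∁B′∣≡3 : ∣ ∁ B′ ∣ ≡ 3
    ∣∁B′∣≡3 = trans (∣∁p∣≡n∸∣p∣ B′) (trans (cong (6 + m ∸_) size) (m+n∸n≡m 3 m))

  weight+[2+m]C2≤[5+m]C3 : {a′ : Fin (6 + m)} {B′ : Subset (6 + m)} → F a′ B′ ≡ true → a ∉ B′ →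
    weight F a + (2 + m) C 2 ≤ (5 + m) C 3
  weight+[2+m]C2≤[5+m]C3 inF a∉B′ = subst₂ (λ d c → weight F a + d ≤ c)
    (#opposed≡[2+m]C2 inF) #flags≡[5+m]C3 (weight+#opposed≤#flags independent a inF a∉B′)

  inAllFlags-if-full : weight F a ≡ (5 + m) C 3 → InAllFlags F a
  inAllFlags-if-full full a′ B′ inF with a ∈? B′
  ... | yes a∈B′ = a∈B′
  ... | no  a∉B′ = contradiction (+-cancelˡ-≤ ((5 + m) C 3) _ 0 (begin
    (5 + m) C 3 + (2 + m) C 2 ≡⟨ cong (_+ (2 + m) C 2) full ⟨
    weight F a + (2 + m) C 2  ≤⟨ weight+[2+m]C2≤[5+m]C3 inF a∉B′ ⟩
    (5 + m) C 3               ≡⟨ +-identityʳ _ ⟨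
    (5 + m) C 3 + 0           ∎)) (<⇒≱ (0<nCk (m≤m+n 2 m)))
    where open ≤-Reasoning

  inAllFlags-if-heavy : ¬ weight F a ≤ (5 + m) C 3 ∸ (2 + m) C 2 → InAllFlags F a
  inAllFlags-if-heavy heavy a′ B′ inF with a ∈? B′
  ... | yes a∈B′ = a∈B′
  ... | no  a∉B′ = contradiction (m+n≤o⇒m≤o∸n _ (weight+[2+m]C2≤[5+m]C3 inF a∉B′)) heavy

  weight≡[5+m]C3 : InAllFlags F a → weight F a ≡ (5 + m) C 3
  weight≡[5+m]C3 inAll = trans (weight≡#flags maximal a inAll) #flags≡[5+m]C3

  weight≤[5+m]C3∸[2+m]C2 : weight F a < (5 + m) C 3 → weight F a ≤ (5 + m) C 3 ∸ (2 + m) C 2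
  weight≤[5+m]C3∸[2+m]C2 lt with weight F a ≤? (5 + m) C 3 ∸ (2 + m) C 2
  ... | yes light = light
  ... | no  heavy = contradiction (weight≡[5+m]C3 (inAllFlags-if-heavy heavy)) (<⇒≢ lt)

lemma2p7 : (n : ℕ) → 7 ≤ n → (F : Family n) → IsMaximalIndependentSet n F → (a : Fin n) →
    ((weight F a ≡ (n ∸ 1) C 3 → ((a′ : Fin n) (B′ : Subset n) → F a′ B′ ≡ true → a ∈ B′)) ×
     (((a′ : Fin n) (B′ : Subset n) → F a′ B′ ≡ true → a ∈ B′) → weight F a ≡ (n ∸ 1) C 3)) ×
    (weight F a < (n ∸ 1) C 3 → weight F a ≤ (n ∸ 1) C 3 ∸ (n ∸ 4) C 2)
lemma2p7 .(6 + suc m) (s≤s (s≤s (s≤s (s≤s (s≤s (s≤s (s≤s {n = m} z≤n))))))) F maximal a =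
  (inAllFlags-if-full maximal a , weight≡[5+m]C3 maximal a) , weight≤[5+m]C3∸[2+m]C2 maximal a
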